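{- Let $T$ be a tournament on vertex set $[n]$, let $B$ be its backedge graph, and let $E'\subseteq E(B)$. If deleting the edges of $E'$ from $B$ yields a $k$-colorable graph, then reversing the arcs of $T$ corresponding to $E'$ yields a $k$-colorable tournament. In particular, if $B$ is $k$-colorable (as a graph) then $T$ is $k$-colorable (as a tournament), and $\mathrm{Dist}_{\mathrm{Tour\text{ - }BP}}(T)\le \mathrm{Dist}_{\mathrm{BP}}(B)$.
   Context: The backedge graph $B=B(T)$ of a tournament $T$ on $[n]$ is the undirected graph on $[n]$ with edge set $\{\{i,j\}: i<j,\ \overrightarrow{ji}\in E(T)\}$; the arc corresponding to $\{i,j\}\in E(B)$ is $\overrightarrow{ji}$. A tournament is $k$-colorable if its vertices can be colored with $k$ colors so that each color class induces a transitive subtournament. $\mathrm{Dist}_{\mathrm{BP}}(B)$ is the minimum number of edges whose removal makes the graph $B$ bipartite; $\mathrm{Dist}_{\mathrm{Tour\text{ - }BP}}(T)$ is the minimum number of arcs of $T$ whose reversal makes $T$ $2$-colorable. -}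

module Defs where

open import Data.Nat using (ℕ; _≤_; _<ᵇ_)
open import Data.Fin using (Fin; toℕ)
open import Data.Bool using (Bool; true; false; _∧_; _∨_; not; if_then_else_)
open import Data.List using (List; map; allFin)
open import Data.Nat.ListAction using (sum)
open import Data.Product using (Σ; _×_; ∃)
open import Data.Sum using (_⊎_)
open import Relation.Binary.PropositionalEquality using (_≡_; _≢_)

Rel₂ : ℕ → Set
Rel₂ n = Fin n → Fin n → Bool

-- A tournament on [n]: arc i j = true means the arc i → j is present.
record IsTournament {n : ℕ} (arc : Rel₂ n) : Set where
  field
    irrefl : ∀ i → arc i i ≡ false
    total  : ∀ i j → i ≢ j → (arc i j ≡ true) ⊎ (arc j i ≡ true)
    asym   : ∀ i j → arc i j ≡ true → arc j i ≡ false

record Tournament (n : ℕ) : Set where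
  field
    arc  : Rel₂ n
    isTournament : IsTournament arc
open Tournament public

_<F_ : ∀ {n} → Fin n → Fin n → Bool
i <F j = toℕ i <ᵇ toℕ j

-- A set of unordered pairs {i,j} (i ≠ j) of [n]; only the entries S i j with
-- i < j are meaningful: {i,j} ∈ S iff S (min i j) (max i j) = true.
PairSet : ℕ → Set
PairSet n = Fin n → Fin n → Bool

_∈P_ : ∀ {n} → (Fin n × Fin n) → PairSet n → Bool
_∈P_ {n} (i Data.Product., j) S = ((i <F j) ∧ S i j) ∨ ((j <F i) ∧ S j i)

size : ∀ {n} → PairSet n → ℕ
size {n} S = sum (map (λ i → sum (map (λ j → if (i <F j) ∧ S i j then 1 else 0) (allFin n))) (allFin n))

-- The backedge graph B(T): {i,j} ∈ E(B) iff i < j and the arc is j → i.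
backedge : ∀ {n} → Tournament n → PairSet n
backedge T i j = arc T j i

deleteEdges : ∀ {n} → PairSet n → PairSet n → PairSet n
deleteEdges E E' i j = E i j ∧ not (E' i j)

_⊆P_ : ∀ {n} → PairSet n → PairSet n → Set
_⊆P_ {n} E' E = ∀ (i j : Fin n) → (i Data.Product., j) ∈P E' ≡ true → (i Data.Product., j) ∈P E ≡ true

reverseArcs : ∀ {n} → Tournament n → PairSet n → Rel₂ n
reverseArcs T R i j = if (i Data.Product., j) ∈P R then arc T j i else arc T i j

GraphColorable : ∀ {n} → ℕ → PairSet n → Set
GraphColorable {n} k E = Σ (Fin n → Fin k) λ c →
  ∀ (i j : Fin n) → (i Data.Product., j) ∈P E ≡ true → c i ≢ c j

-- k-colorability of a tournament (given by its arc relation): every color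
-- class induces a transitive subtournament.
TourColorable : ∀ {n} → ℕ → Rel₂ n → Set
TourColorable {n} k arc = Σ (Fin n → Fin k) λ c →
  ∀ (x y z : Fin n) → c x ≡ c y → c y ≡ c z →
    arc x y ≡ true → arc y z ≡ true → arc x z ≡ true

IsDistBP : ∀ {n} → PairSet n → ℕ → Set
IsDistBP {n} E d =
  (Σ (PairSet n) λ E' → (E' ⊆P E) × (size E' ≡ d) × GraphColorable 2 (deleteEdges E E'))
  × (∀ (E' : PairSet n) → E' ⊆P E → GraphColorable 2 (deleteEdges E E') → d ≤ size E')

IsDistTourBP : ∀ {n} → Tournament n → ℕ → Set
IsDistTourBP {n} T d =
  (Σ (PairSet n) λ R → (size R ≡ d) × TourColorable 2 (reverseArcs T R))
  × (∀ (R : PairSet n) → TourColorable 2 (reverseArcs T R) → d ≤ size R)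

-- Within a colour class of a proper colouring of B(T) there are no backedges, so every arc
-- of the class points forward in the order of [n] and the class is transitive.  Reversing
-- the arcs of T over E' ⊆ E(B) turns exactly those backedges into forward arcs, so
-- B(T with E' reversed) ⊆ B ∖ E' and the first claim follows from the second.  Applied
-- with k = 2 to an optimal E', this gives Dist_Tour-BP(T) ≤ Dist_BP(B).
module Submission where

open import Defs
open import Data.Nat using (ℕ; _≤_)
open import Data.Nat.Properties using (<ᵇ⇒<; <⇒<ᵇ)
open import Data.Fin using (Fin; toℕ; _<_)
open import Data.Fin.Properties using (<-cmp; <-trans; <-asym; <⇒≢)
open import Data.Bool using (T; true; false; _∧_)
open import Data.Bool.Properties using (T-≡; T-∧; T-∨; ∨-comm; ∨-identityʳ)
open import Data.Product using (_×_; _,_; proj₂)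
open import Data.Sum using (_⊎_; inj₁; inj₂)
import Data.Sum as Sum
open import Function using (_∘_)
open import Function.Bundles using (module Equivalence)
open import Relation.Binary using (tri<; tri≈; tri>)
open import Relation.Binary.PropositionalEquality using (_≡_; _≢_; refl; sym; trans)
open import Relation.Nullary using (contradiction)

open Equivalence using (to; from)

module _ {n : ℕ} where

  <⇒<F : {i j : Fin n} → i < j → (i <F j) ≡ true
  <⇒<F = to T-≡ ∘ <⇒<ᵇ

  <F⇒< : {i j : Fin n} → (i <F j) ≡ true → i < j
  <F⇒< {i} {j} = <ᵇ⇒< (toℕ i) (toℕ j) ∘ from T-≡

  ∈P-sym : (i j : Fin n) (S : PairSet n) → (i , j) ∈P S ≡ (j , i) ∈P S
  ∈P-sym i j S = ∨-comm ((i <F j) ∧ S i j) ((j <F i) ∧ S j i)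

  ∈P-ordered : {i j : Fin n} → i < j → (S : PairSet n) → (i , j) ∈P S ≡ S i j
  ∈P-ordered {i} {j} i<j S rewrite <⇒<F i<j with j <F i in j<Fi
  ... | true  = contradiction (<F⇒< j<Fi) (<-asym i<j)
  ... | false = ∨-identityʳ (S i j)

  ∈P-swapped : {i j : Fin n} → i < j → (S : PairSet n) → (j , i) ∈P S ≡ S i j
  ∈P-swapped {i} {j} i<j S = trans (∈P-sym j i S) (∈P-ordered i<j S)

  ∈P-elim : {i j : Fin n} (S : PairSet n) → (i , j) ∈P S ≡ true
    → (i < j × S i j ≡ true) ⊎ (j < i × S j i ≡ true)
  ∈P-elim S = Sum.map split split ∘ to T-∨ ∘ from T-≡
    where
    split : ∀ {i j} → T ((i <F j) ∧ S i j) → i < j × S i j ≡ true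
    split {i} {j} t with to T-∧ t
    ... | i<Fj , s = <ᵇ⇒< (toℕ i) (toℕ j) i<Fj , to T-≡ s

  ⊆P-fromOrdered : {S S' : PairSet n}
    → (∀ {i j} → i < j → S i j ≡ true → S' i j ≡ true) → S ⊆P S'
  ⊆P-fromOrdered {S} {S'} h i j ij∈S with ∈P-elim {i} {j} S ij∈S
  ... | inj₁ (i<j , s) = trans (∈P-ordered i<j S') (h i<j s)
  ... | inj₂ (j<i , s) = trans (∈P-swapped j<i S') (h j<i s)

  GraphColorable-antimono : {k : ℕ} {E E' : PairSet n}
    → E ⊆P E' → GraphColorable k E' → GraphColorable k E
  GraphColorable-antimono E⊆E' (c , proper) = c , λ i j ij∈E → proper i j (E⊆E' i j ij∈E)

  backedge-colorable⇒colorable : {k : ℕ} (T : Tournament n)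
    → GraphColorable k (backedge T) → TourColorable k (arc T)
  backedge-colorable⇒colorable T (c , proper) = c , transitive
    where
    open IsTournament (isTournament T)

    arc⇒< : ∀ {x y} → arc T x y ≡ true → c x ≡ c y → x < y
    arc⇒< {x} {y} xy cxy with <-cmp x y
    ... | tri< x<y _ _ = x<y
    ... | tri≈ _ refl _ = contradiction (trans (sym xy) (irrefl x)) λ ()
    ... | tri> _ _ y<x = contradiction cxy (proper x y (trans (∈P-swapped y<x (backedge T)) xy))

    <⇒arc : ∀ {x z} → x < z → c x ≡ c z → arc T x z ≡ true
    <⇒arc {x} {z} x<z cxz with total x z (<⇒≢ x<z)
    ... | inj₁ xz = xz
    ... | inj₂ zx = contradiction (arc⇒< zx (sym cxz)) (<-asym x<z)

    transitive : ∀ x y z → c x ≡ c y → c y ≡ c z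
      → arc T x y ≡ true → arc T y z ≡ true → arc T x z ≡ true
    transitive x y z cxy cyz xy yz =
      <⇒arc (<-trans (arc⇒< xy cxy) (arc⇒< yz cyz)) (trans cxy cyz)

  reverseArcs-isTournament : (T : Tournament n) (R : PairSet n) → IsTournament (reverseArcs T R)
  reverseArcs-isTournament T R = record { irrefl = irrefl′ ; total = total′ ; asym = asym′ }
    where
    open IsTournament (isTournament T)

    irrefl′ : ∀ i → reverseArcs T R i i ≡ false
    irrefl′ i with (i , i) ∈P R
    ... | true  = irrefl i
    ... | false = irrefl i

    total′ : ∀ i j → i ≢ j → (reverseArcs T R i j ≡ true) ⊎ (reverseArcs T R j i ≡ true)
    total′ i j i≢j rewrite ∈P-sym j i R with (i , j) ∈P R
    ... | true  = Sum.swap (total i j i≢j)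
    ... | false = total i j i≢j

    asym′ : ∀ i j → reverseArcs T R i j ≡ true → reverseArcs T R j i ≡ false
    asym′ i j rewrite ∈P-sym j i R with (i , j) ∈P R
    ... | true  = asym j i
    ... | false = asym i j

  reverse : Tournament n → PairSet n → Tournament n
  reverse T R = record { arc = reverseArcs T R ; isTournament = reverseArcs-isTournament T R }

  backedge-reverse-⊆ : (T : Tournament n) (E' : PairSet n) → E' ⊆P backedge T
    → backedge (reverse T E') ⊆P deleteEdges (backedge T) E'
  backedge-reverse-⊆ T E' E'⊆B = ⊆P-fromOrdered ordered
    where
    ordered : ∀ {i j} → i < j → backedge (reverse T E') i j ≡ true
      → deleteEdges (backedge T) E' i j ≡ true
    ordered {i} {j} i<j ij with (j , i) ∈P E' in ji∈E'
    ... | true  = contradiction (trans (sym ij) (IsTournament.asym (isTournament T) j i ji))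
                                λ ()
      where
      ji : arc T j i ≡ true
      ji = trans (sym (∈P-ordered i<j (backedge T)))
                 (E'⊆B i j (trans (∈P-sym i j E') ji∈E'))
    ... | false rewrite trans (sym (∈P-swapped i<j E')) ji∈E' | ij = refl

mainTheorem7 : ∀ (n : ℕ) (T : Tournament n)
    → (∀ (k : ℕ) (E' : PairSet n) → E' ⊆P backedge T
    → GraphColorable k (deleteEdges (backedge T) E')
    → IsTournament (reverseArcs T E') × TourColorable k (reverseArcs T E'))
    × (∀ (k : ℕ) → GraphColorable k (backedge T) → TourColorable k (arc T))
    × (∀ (d₁ d₂ : ℕ) → IsDistTourBP T d₁ → IsDistBP (backedge T) d₂ → d₁ ≤ d₂)
mainTheorem7 n T = reversal , (λ k → backedge-colorable⇒colorable T) , distance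
  where
  reversal : ∀ k E' → E' ⊆P backedge T → GraphColorable k (deleteEdges (backedge T) E')
    → IsTournament (reverseArcs T E') × TourColorable k (reverseArcs T E')
  reversal k E' E'⊆B colorable =
    reverseArcs-isTournament T E' ,
    backedge-colorable⇒colorable (reverse T E')
      (GraphColorable-antimono (backedge-reverse-⊆ T E' E'⊆B) colorable)

  distance : ∀ d₁ d₂ → IsDistTourBP T d₁ → IsDistBP (backedge T) d₂ → d₁ ≤ d₂
  distance d₁ .(size E') (_ , minimal) ((E' , E'⊆B , refl , colorable) , _) =
    minimal E' (proj₂ (reversal 2 E' E'⊆B colorable))
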